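{- If $n \geq 4$, then $\operatorname{mob}(L(K_n)) = n-2$.
   Context: $L(G)$ is the line graph of $G$: its vertices are the edges of $G$, two adjacent if the edges share an endpoint; $K_n$ is the complete graph. A set $S$ of vertices is a general position set if no three distinct vertices of $S$ lie on a common shortest path. Place a robot on each vertex of a general position set $S$; robots move one at a time, a move being legal if the robot moves to an adjacent unoccupied vertex and the new set of occupied vertices is again in general position. $S$ is a mobile general position set if some sequence of legal moves lets every vertex be visited by at least one robot. $\operatorname{mob}(G)$ denotes the largest cardinality of a mobile general position set of $G$. -}

module Defs where

open import Level using (Level; _⊔_) renaming (suc to lsuc)
open import Data.Nat using (ℕ; zero; suc; _≤_; _∸_)
open import Data.Fin using (Fin) renaming (_<_ to _<F_)
open import Data.Product using (Σ; ∃; ∃-syntax; _×_; _,_; proj₁; proj₂)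
open import Data.Sum using (_⊎_)
open import Data.List using (List; []; _∷_; _++_; length)
open import Data.List.Membership.Propositional using (_∈_; _∉_)
open import Data.List.Relation.Unary.Unique.Propositional using (Unique)
open import Relation.Binary.PropositionalEquality using (_≡_; _≢_)
open import Relation.Nullary using (¬_)

record Graph : Set₁ where
  field
    V   : Set
    Adj : V → V → Set

module _ (G : Graph) where
  open Graph G

  data Walk : V → V → Set where
    []  : ∀ {x} → Walk x x
    _∷_ : ∀ {x y z} → Adj x y → Walk y z → Walk x z

  walkLength : ∀ {x y} → Walk x y → ℕ
  walkLength []      = 0
  walkLength (_ ∷ w) = suc (walkLength w)

  data OnWalk (v : V) : ∀ {x y} → Walk x y → Set where
    here  : ∀ {y} {w : Walk v y} → OnWalk v w
    there : ∀ {x y z} {a : Adj x y} {w : Walk y z} → OnWalk v w → OnWalk v (a ∷ w)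

  IsShortest : ∀ {x y} → Walk x y → Set
  IsShortest {x} {y} p = ∀ (q : Walk x y) → walkLength p ≤ walkLength q

  OnCommonGeodesic : V → V → V → Set
  OnCommonGeodesic u v w =
    ∃[ x ] ∃[ y ] Σ (Walk x y) λ p →
      IsShortest p × OnWalk u p × OnWalk v p × OnWalk w p

  IsGeneralPosition : List V → Set
  IsGeneralPosition S =
    Unique S ×
    (∀ {u v w} → u ∈ S → v ∈ S → w ∈ S →
       u ≢ v → v ≢ w → u ≢ w → ¬ OnCommonGeodesic u v w)

  -- a legal move: one robot moves along an edge to an unoccupied vertex,
  -- and the new occupied set is again in general position
  LegalMove : List V → List V → Set
  LegalMove S S' =
    ∃[ xs ] ∃[ ys ] ∃[ u ] ∃[ v ]
      (S ≡ xs Data.List.++ (u ∷ ys)) × (S' ≡ xs Data.List.++ (v ∷ ys)) ×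
      Adj u v × v ∉ S × IsGeneralPosition S'

  -- Run S cs : cs is the sequence of configurations of a finite sequence
  -- of legal moves starting from configuration S (cs includes S)
  data Run : List V → List (List V) → Set where
    stop : ∀ {S} → Run S (S ∷ [])
    step : ∀ {S S' cs} → LegalMove S S' → Run S' cs → Run S (S ∷ cs)

  IsMobileGP : List V → Set
  IsMobileGP S =
    IsGeneralPosition S ×
    ∃[ cs ] (Run S cs × (∀ (v : V) → ∃[ C ] (C ∈ cs × v ∈ C)))

  MobEq : ℕ → Set
  MobEq k =
    (∃[ S ] (IsMobileGP S × length S ≡ k)) ×
    (∀ S → IsMobileGP S → length S ≤ k)

-- Line graph of the complete graph K_n: vertices are the edges {i,j} of K_n,
-- represented as pairs (i , j) with i < j; two are adjacent iff they are
-- distinct edges sharing an endpoint.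
EdgeK : ℕ → Set
EdgeK n = Σ (Fin n × Fin n) λ p → proj₁ p <F proj₂ p

LineK : ℕ → Graph
LineK n = record
  { V   = EdgeK n
  ; Adj = λ e f →
      e ≢ f ×
      ( (proj₁ (proj₁ e) ≡ proj₁ (proj₁ f)) ⊎ (proj₁ (proj₁ e) ≡ proj₂ (proj₁ f)) ⊎
        (proj₂ (proj₁ e) ≡ proj₁ (proj₁ f)) ⊎ (proj₂ (proj₁ e) ≡ proj₂ (proj₁ f)) )
  }

{-# OPTIONS --safe #-}
module Submission where

-- Since L(K_n) has diameter 2, a set S of edges of K_n is in general position exactly when sharing
-- an endpoint is transitive on S, i.e. S is a vertex-disjoint union of stars and triangles.
--
-- Lower bound: the star at c whose n − 2 spokes avoid the point 0 can be moved spoke by spoke onto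
-- the star at 0, and from there onto the star at any other center c′; sweeping through the centers
-- 1, …, n − 1 in turn visits every edge.
--
-- Upper bound: sending each edge of S to an endpoint on no other edge (in a triangle, one vertex per
-- edge) is injective, and misses every uncovered point and every star center; so if |S| ≥ n − 1
-- there is at most one such spare point. This forces a legal move {a, b} ↦ {a, c} to happen only
-- when {b, c} ∈ S, so the partition of the points into components never changes. Hence either two
-- points stay in different components and the edge joining them is never occupied, or S is the
-- spanning star, which cannot move at all.

open import Defs
open import Data.Nat as ℕ using (ℕ; suc; _≤_; _∸_; z≤n; s≤s)
import Data.Nat.Properties as ℕP
open import Data.Fin using (Fin; _<_)
open import Data.Fin.Properties using (_≟_; _<?_; suc-injective; injective⇒≤; <-cmp; <-irrefl; <-asym; <-irrelevant; any?; pigeonhole)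
open import Data.Product as Prod using (Σ; ∃; ∃₂; _×_; _,_; proj₁; proj₂; map₁; map₂)
open import Data.Sum as Sum using (_⊎_; inj₁; inj₂)
open import Data.Empty using (⊥; ⊥-elim; ⊥-elim-irr)
open import Data.List using (List; []; _∷_; _++_; length; filter; allFin; tabulate; lookup)
open import Data.List.Properties using (length-++; ++-assoc; length-tabulate)
open import Data.List.Membership.Propositional using (_∈_; _∉_; find; lose)
open import Data.List.Membership.Propositional.Properties using (∈-++⁺ˡ; ∈-++⁺ʳ; ∈-++⁻; ∈-insert; ∈-∃++; ∈-filter⁺; ∈-filter⁻; ∈-allFin; ∈-tabulate⁺; ∈-tabulate⁻; ∈-lookup)
open import Data.List.Relation.Unary.Any as Any using (here; there)
open import Data.List.Relation.Unary.All as All using (All)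
open import Data.List.Relation.Unary.AllPairs using ([]; _∷_)
open import Data.List.Relation.Unary.Unique.Propositional using (Unique)
import Data.List.Relation.Unary.Unique.Propositional.Properties as Unique
open import Relation.Binary.PropositionalEquality
open import Relation.Binary.Definitions using (DecidableEquality; tri<; tri≈; tri>)
open import Function using (_∘_; id)
open import Relation.Nullary using (¬_; Dec; yes; no)
open import Relation.Unary using (Decidable)
open import Relation.Nullary.Decidable as Dec using (¬?; _×-dec_)

avoid-three : ∀ {m} → 3 ℕ.< m → (a b c : Fin m) → ∃ λ z → z ≢ a × z ≢ b × z ≢ c
avoid-three {m} 3<m a b c with any? (λ z → ¬? (z ≟ a) ×-dec ¬? (z ≟ b) ×-dec ¬? (z ≟ c))
... | yes found = found
... | no none = ⊥-elim (no-collision (pigeonhole 3<m which))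
  where
    open ≡-Reasoning
    point : Fin 3 → Fin m
    point Fin.zero = a
    point (Fin.suc Fin.zero) = b
    point (Fin.suc (Fin.suc _)) = c
    which : Fin m → Fin 3
    which z with z ≟ a | z ≟ b
    ... | yes _ | _     = Fin.zero
    ... | no _  | yes _ = Fin.suc Fin.zero
    ... | no _  | no _  = Fin.suc (Fin.suc Fin.zero)
    point-which : ∀ z → point (which z) ≡ z
    point-which z with z ≟ a | z ≟ b
    ... | yes z≡a | _       = sym z≡a
    ... | no _    | yes z≡b = sym z≡b
    ... | no z≢a  | no z≢b with z ≟ c
    ...   | yes z≡c = sym z≡c
    ...   | no z≢c  = ⊥-elim (none (z , z≢a , z≢b , z≢c))
    no-collision : ¬ ∃₂ (λ i j → i < j × which i ≡ which j)
    no-collision (i , j , i<j , same) = <-irrefl (begin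
      i                ≡⟨ point-which i ⟨
      point (which i)  ≡⟨ cong point same ⟩
      point (which j)  ≡⟨ point-which j ⟩
      j                ∎) i<j

∃∈? : ∀ {A : Set} {P : A → Set} → Decidable P → (xs : List A) → Dec (∃ λ x → x ∈ xs × P x)
∃∈? P? xs = Dec.map′ find (λ (x , x∈ , Px) → lose x∈ Px) (Any.any? P? xs)

lookup-injective : ∀ {A : Set} {xs : List A} → Unique xs → ∀ {i j} → lookup xs i ≡ lookup xs j → i ≡ j
lookup-injective (_ ∷ _)      {Fin.zero}  {Fin.zero}  _  = refl
lookup-injective (x∉ ∷ _)     {Fin.zero}  {Fin.suc j} eq = ⊥-elim (All.lookup x∉ (∈-lookup j) eq)
lookup-injective (x∉ ∷ _)     {Fin.suc i} {Fin.zero}  eq = ⊥-elim (All.lookup x∉ (∈-lookup i) (sym eq))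
lookup-injective (_ ∷ unique) {Fin.suc i} {Fin.suc j} eq = cong Fin.suc (lookup-injective unique eq)

module Edges {n : ℕ} where
  Edge : Set
  Edge = EdgeK n

  lo hi : Edge → Fin n
  lo e = proj₁ (proj₁ e)
  hi e = proj₂ (proj₁ e)

  lo<hi : (e : Edge) → lo e < hi e
  lo<hi = proj₂

  lo≢hi : (e : Edge) → lo e ≢ hi e
  lo≢hi e lo≡hi = <-irrefl lo≡hi (lo<hi e)

  infix 4 _∋_
  data _∋_ (e : Edge) (x : Fin n) : Set where
    lo∋ : lo e ≡ x → e ∋ x
    hi∋ : hi e ≡ x → e ∋ x

  ∋-lo : (e : Edge) → e ∋ lo e
  ∋-lo e = lo∋ refl

  ∋-hi : (e : Edge) → e ∋ hi e
  ∋-hi e = hi∋ refl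

  edge-≡ : ∀ {e f : Edge} → lo e ≡ lo f → hi e ≡ hi f → e ≡ f
  edge-≡ {(x , y) , p} {(.x , .y) , q} refl refl = cong ((x , y) ,_) (<-irrelevant p q)

  _≟ₑ_ : DecidableEquality Edge
  e ≟ₑ f with lo e ≟ lo f | hi e ≟ hi f
  ... | yes p | yes q = yes (edge-≡ p q)
  ... | no p  | _     = no (λ e≡f → p (cong lo e≡f))
  ... | _     | no q  = no (λ e≡f → q (cong hi e≡f))

  _∋?_ : (e : Edge) (x : Fin n) → Dec (e ∋ x)
  e ∋? x with lo e ≟ x | hi e ≟ x
  ... | yes p | _     = yes (lo∋ p)
  ... | no _  | yes q = yes (hi∋ q)
  ... | no p  | no q  = no λ { (lo∋ r) → p r ; (hi∋ r) → q r }

  HasEdge : List Edge → Fin n → Fin n → Set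
  HasEdge C x y = ∃ λ e → e ∈ C × e ∋ x × e ∋ y

  has? : ∀ C x y → Dec (HasEdge C x y)
  has? C x y = ∃∈? (λ e → e ∋? x ×-dec e ∋? y) C

  ∋-either : ∀ {e x y z} → x ≢ y → e ∋ x → e ∋ y → e ∋ z → z ≡ x ⊎ z ≡ y
  ∋-either x≢y (lo∋ a) (lo∋ b) _       = ⊥-elim (x≢y (trans (sym a) b))
  ∋-either x≢y (hi∋ a) (hi∋ b) _       = ⊥-elim (x≢y (trans (sym a) b))
  ∋-either x≢y (lo∋ a) (hi∋ b) (lo∋ c) = inj₁ (trans (sym c) a)
  ∋-either x≢y (lo∋ a) (hi∋ b) (hi∋ c) = inj₂ (trans (sym c) b)
  ∋-either x≢y (hi∋ a) (lo∋ b) (lo∋ c) = inj₂ (trans (sym c) b)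
  ∋-either x≢y (hi∋ a) (lo∋ b) (hi∋ c) = inj₁ (trans (sym c) a)

  ∋∌⇒≢ : ∀ {e x y} → e ∋ x → ¬ e ∋ y → x ≢ y
  ∋∌⇒≢ ex e∌y x≡y = e∌y (subst (_ ∋_) x≡y ex)

  ∌-third : ∀ {e x y z} → x ≢ y → e ∋ x → e ∋ y → z ≢ x → z ≢ y → ¬ e ∋ z
  ∌-third x≢y ex ey z≢x z≢y ez with ∋-either x≢y ex ey ez
  ... | inj₁ z≡x = z≢x z≡x
  ... | inj₂ z≡y = z≢y z≡y

  ∋-ordered : ∀ {e x y} → e ∋ x → e ∋ y → x < y → lo e ≡ x × hi e ≡ y
  ∋-ordered (lo∋ p) (hi∋ q) _   = p , q
  ∋-ordered (lo∋ p) (lo∋ q) x<y = ⊥-elim (<-irrefl (trans (sym p) q) x<y)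
  ∋-ordered (hi∋ p) (hi∋ q) x<y = ⊥-elim (<-irrefl (trans (sym p) q) x<y)
  ∋-ordered {e} (hi∋ p) (lo∋ q) x<y = ⊥-elim (<-asym x<y (subst₂ _<_ q p (lo<hi e)))

  ∋-unique-ordered : ∀ {e f x y} → x < y → e ∋ x → e ∋ y → f ∋ x → f ∋ y → e ≡ f
  ∋-unique-ordered x<y ex ey fx fy =
    let (lo-e , hi-e) = ∋-ordered ex ey x<y
        (lo-f , hi-f) = ∋-ordered fx fy x<y
    in edge-≡ (trans lo-e (sym lo-f)) (trans hi-e (sym hi-f))

  ∋-unique : ∀ {e f x y} → x ≢ y → e ∋ x → e ∋ y → f ∋ x → f ∋ y → e ≡ f
  ∋-unique {x = x} {y} x≢y ex ey fx fy with <-cmp x y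
  ... | tri< x<y _ _ = ∋-unique-ordered x<y ex ey fx fy
  ... | tri≈ _ x≡y _ = ⊥-elim (x≢y x≡y)
  ... | tri> _ _ y<x = ∋-unique-ordered y<x ey ex fy fx

  has⇒∈ : ∀ {C x y v} → x ≢ y → HasEdge C x y → v ∋ x → v ∋ y → v ∈ C
  has⇒∈ x≢y (e , e∈ , ex , ey) vx vy = subst (_∈ _) (∋-unique x≢y ex ey vx vy) e∈

  other : Edge → Fin n → Fin n
  other e x with lo e ≟ x
  ... | yes _ = hi e
  ... | no _  = lo e

  ∋-other : ∀ e x → e ∋ other e x
  ∋-other e x with lo e ≟ x
  ... | yes _ = hi∋ refl
  ... | no _  = lo∋ refl

  other-≢ : ∀ {e x} → e ∋ x → x ≢ other e x
  other-≢ {e} {x} ex with lo e ≟ x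
  ... | yes lo≡x = λ x≡hi → lo≢hi e (trans lo≡x x≡hi)
  other-≢ (lo∋ lo≡x) | no lo≢x = ⊥-elim (lo≢x lo≡x)
  other-≢ (hi∋ hi≡x) | no lo≢x = λ x≡lo → lo≢x (sym x≡lo)

  other-distinct : ∀ {e e′ z} → e ≢ e′ → e ∋ z → e′ ∋ z → other e z ≢ other e′ z
  other-distinct {e} {e′} {z} e≢e′ ez e′z w≡w′ =
    e≢e′ (∋-unique (other-≢ ez) ez (∋-other e z) e′z (subst (e′ ∋_) (sym w≡w′) (∋-other e′ z)))

  other-lo : ∀ {e z} → hi e ≡ z → other e z ≡ lo e
  other-lo {e} {z} hi≡z with lo e ≟ z
  ... | yes lo≡z = ⊥-elim (lo≢hi e (trans lo≡z (sym hi≡z)))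
  ... | no _     = refl

  edge : (x y : Fin n) → .(x ≢ y) → Edge
  edge x y x≢y with <-cmp x y
  ... | tri< x<y _ _   = (x , y) , x<y
  ... | tri≈ _ x≡y _   = ⊥-elim-irr (x≢y x≡y)
  ... | tri> _ _ y<x   = (y , x) , y<x

  edge-∋ˡ : ∀ {x y} (x≢y : x ≢ y) → edge x y x≢y ∋ x
  edge-∋ˡ {x} {y} x≢y with <-cmp x y
  ... | tri< _ _ _   = lo∋ refl
  ... | tri≈ _ x≡y _ = ⊥-elim (x≢y x≡y)
  ... | tri> _ _ _   = hi∋ refl

  edge-∋ʳ : ∀ {x y} (x≢y : x ≢ y) → edge x y x≢y ∋ y
  edge-∋ʳ {x} {y} x≢y with <-cmp x y
  ... | tri< _ _ _   = hi∋ refl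
  ... | tri≈ _ x≡y _ = ⊥-elim (x≢y x≡y)
  ... | tri> _ _ _   = lo∋ refl

module LineGraph {n : ℕ} where
  open Edges {n}

  L : Graph
  L = LineK n

  Adj : Edge → Edge → Set
  Adj = Graph.Adj L

  Meet : Edge → Edge → Set
  Meet e f = ∃ λ x → e ∋ x × f ∋ x

  meet-refl : ∀ e → Meet e e
  meet-refl e = lo e , ∋-lo e , ∋-lo e

  meet-sym : ∀ {e f} → Meet e f → Meet f e
  meet-sym (x , ex , fx) = x , fx , ex

  meet? : ∀ e f → Dec (Meet e f)
  meet? e f with f ∋? lo e | f ∋? hi e
  ... | yes f∋lo | _        = yes (lo e , ∋-lo e , f∋lo)
  ... | no _     | yes f∋hi = yes (hi e , ∋-hi e , f∋hi)
  ... | no f∌lo  | no f∌hi  = no λ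
    { (x , lo∋ refl , fx) → f∌lo fx
    ; (x , hi∋ refl , fx) → f∌hi fx }

  adj⇒meet : ∀ {e f} → Adj e f → Meet e f
  adj⇒meet (_ , inj₁ p)               = _ , lo∋ refl , lo∋ (sym p)
  adj⇒meet (_ , inj₂ (inj₁ p))        = _ , lo∋ refl , hi∋ (sym p)
  adj⇒meet (_ , inj₂ (inj₂ (inj₁ p))) = _ , hi∋ refl , lo∋ (sym p)
  adj⇒meet (_ , inj₂ (inj₂ (inj₂ p))) = _ , hi∋ refl , hi∋ (sym p)

  meet⇒adj : ∀ {e f} → e ≢ f → Meet e f → Adj e f
  meet⇒adj e≢f (x , lo∋ a , lo∋ b) = e≢f , inj₁ (trans a (sym b))
  meet⇒adj e≢f (x , lo∋ a , hi∋ b) = e≢f , inj₂ (inj₁ (trans a (sym b)))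
  meet⇒adj e≢f (x , hi∋ a , lo∋ b) = e≢f , inj₂ (inj₂ (inj₁ (trans a (sym b))))
  meet⇒adj e≢f (x , hi∋ a , hi∋ b) = e≢f , inj₂ (inj₂ (inj₂ (trans a (sym b))))

  ¬meet-apart : ∀ {e f x y p q} → x ≢ y → p ≢ q → e ∋ x → e ∋ y → f ∋ p → f ∋ q →
                x ≢ p → x ≢ q → y ≢ p → y ≢ q → ¬ Meet e f
  ¬meet-apart x≢y p≢q ex ey fp fq x≢p x≢q y≢p y≢q (r , er , fr)
    with ∋-either x≢y ex ey er | ∋-either p≢q fp fq fr
  ... | inj₁ refl | inj₁ refl = x≢p refl
  ... | inj₁ refl | inj₂ refl = x≢q refl
  ... | inj₂ refl | inj₁ refl = y≢p refl
  ... | inj₂ refl | inj₂ refl = y≢q refl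

  walk≤2 : ∀ e f → Σ (Walk L e f) λ w → walkLength L w ≤ 2
  walk≤2 e f with e ≟ₑ f | meet? e f
  ... | yes refl | _      = [] , z≤n
  ... | no e≢f   | yes ef = (meet⇒adj e≢f ef ∷ []) , s≤s z≤n
  ... | no _     | no ¬ef =
    (meet⇒adj e≢g (hi e , ∋-hi e , g∋hi) ∷ meet⇒adj g≢f (lo f , g∋lo , ∋-lo f) ∷ []) , s≤s (s≤s z≤n)
    where
      hi≢lo : hi e ≢ lo f
      hi≢lo hi≡lo = ¬ef (hi e , ∋-hi e , lo∋ (sym hi≡lo))
      g : Edge
      g = edge (hi e) (lo f) hi≢lo
      g∋hi : g ∋ hi e
      g∋hi = edge-∋ˡ hi≢lo
      g∋lo : g ∋ lo f
      g∋lo = edge-∋ʳ hi≢lo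
      e≢g : e ≢ g
      e≢g e≡g = ¬ef (lo f , subst (_∋ lo f) (sym e≡g) g∋lo , ∋-lo f)
      g≢f : g ≢ f
      g≢f g≡f = ¬ef (hi e , ∋-hi e , subst (_∋ hi e) g≡f g∋hi)

  shortest≤2 : ∀ {e f} {w : Walk L e f} → IsShortest L w → walkLength L w ≤ 2
  shortest≤2 {e} {f} shortest = ℕP.≤-trans (shortest (proj₁ (walk≤2 e f))) (proj₂ (walk≤2 e f))

  Separated : List Edge → Fin n → Fin n → Set
  Separated S p q = ∀ {e f} → e ∈ S → f ∈ S → e ∋ p → f ∋ q → ¬ Meet e f

  separated-sym : ∀ {S p q} → Separated S p q → Separated S q p
  separated-sym separated e∈ f∈ eq fp = separated f∈ e∈ fp eq ∘ meet-sym

  MeetTransitive : List Edge → Set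
  MeetTransitive S = ∀ {e f g} → e ∈ S → f ∈ S → g ∈ S → Meet e f → Meet f g → Meet e g

  induced-path-geodesic : ∀ {e f g} → Adj e f → Adj f g → ¬ Meet e g → OnCommonGeodesic L e f g
  induced-path-geodesic {e} {f} {g} ef fg ¬eg =
    e , g , (ef ∷ fg ∷ []) , shortest , here , there here , there (there here)
    where
      shortest : IsShortest L (ef ∷ fg ∷ [])
      shortest []          = ⊥-elim (¬eg (meet-refl e))
      shortest (eg ∷ [])   = ⊥-elim (¬eg (adj⇒meet eg))
      shortest (_ ∷ _ ∷ _) = s≤s (s≤s z≤n)

  gp⇒meet-trans : ∀ {S} → IsGeneralPosition L S → MeetTransitive S
  gp⇒meet-trans (_ , no-geodesic) {e} {f} {g} eS fS gS ef fg
    with e ≟ₑ f | f ≟ₑ g | meet? e g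
  ... | yes refl | _        | _      = fg
  ... | _        | yes refl | _      = ef
  ... | _        | _        | yes eg = eg
  ... | no e≢f   | no f≢g   | no ¬eg =
    ⊥-elim (no-geodesic eS fS gS e≢f f≢g (λ { refl → ¬eg (meet-refl e) })
             (induced-path-geodesic (meet⇒adj e≢f ef) (meet⇒adj f≢g fg) ¬eg))

  private
    Among : Edge → Edge → Edge → Edge → Set
    Among x y z u = u ≡ x ⊎ u ≡ y ⊎ u ≡ z

    among-swap : ∀ {x y z u} → Among x y z u → Among y x z u
    among-swap (inj₁ p)        = inj₂ (inj₁ p)
    among-swap (inj₂ (inj₁ p)) = inj₁ p
    among-swap (inj₂ (inj₂ p)) = inj₂ (inj₂ p)

    among-rotate : ∀ {x y z u} → Among x y z u → Among z x y u
    among-rotate (inj₁ p)        = inj₂ (inj₁ p)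
    among-rotate (inj₂ (inj₁ p)) = inj₂ (inj₂ p)
    among-rotate (inj₂ (inj₂ p)) = inj₁ p

    no-three-among-two : ∀ {u v w x y : Edge} → u ≢ v → v ≢ w → u ≢ w →
                         u ≡ x ⊎ u ≡ y → v ≡ x ⊎ v ≡ y → w ≡ x ⊎ w ≡ y → ⊥
    no-three-among-two u≢v _ _ (inj₁ refl) (inj₁ refl) _ = u≢v refl
    no-three-among-two u≢v _ _ (inj₂ refl) (inj₂ refl) _ = u≢v refl
    no-three-among-two _ v≢w u≢w (inj₁ refl) (inj₂ refl) (inj₁ refl) = u≢w refl
    no-three-among-two _ v≢w u≢w (inj₁ refl) (inj₂ refl) (inj₂ refl) = v≢w refl
    no-three-among-two _ v≢w u≢w (inj₂ refl) (inj₁ refl) (inj₁ refl) = v≢w refl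
    no-three-among-two _ v≢w u≢w (inj₂ refl) (inj₁ refl) (inj₂ refl) = u≢w refl

    first-among-three : ∀ {S : List Edge} {u v w x y z} → u ∈ S → v ∈ S → w ∈ S →
      u ≢ v → v ≢ w → u ≢ w → Among x y z u → Among x y z v → Among x y z w → x ∈ S
    first-among-three uS _ _ _ _ _ (inj₁ refl) _ _ = uS
    first-among-three _ vS _ _ _ _ _ (inj₁ refl) _ = vS
    first-among-three _ _ wS _ _ _ _ _ (inj₁ refl) = wS
    first-among-three _ _ _ u≢v v≢w u≢w (inj₂ u∈) (inj₂ v∈) (inj₂ w∈) =
      ⊥-elim (no-three-among-two u≢v v≢w u≢w u∈ v∈ w∈)

    onWalk₀ : ∀ {u x} → OnWalk L u {x} {x} [] → u ≡ x
    onWalk₀ here = refl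

    onWalk₁ : ∀ {u x y} {a : Adj x y} → OnWalk L u (a ∷ []) → u ≡ x ⊎ u ≡ y
    onWalk₁ here      = inj₁ refl
    onWalk₁ (there o) = inj₂ (onWalk₀ o)

    onWalk₂ : ∀ {u x y z} {a : Adj x y} {b : Adj y z} → OnWalk L u (a ∷ b ∷ []) → Among x y z u
    onWalk₂ here      = inj₁ refl
    onWalk₂ (there o) = inj₂ (onWalk₁ o)

  meet-trans⇒gp : ∀ {S} → Unique S → MeetTransitive S → IsGeneralPosition L S
  meet-trans⇒gp {S} unique meet-trans = unique , no-geodesic
    where
      no-geodesic : ∀ {u v w} → u ∈ S → v ∈ S → w ∈ S → u ≢ v → v ≢ w → u ≢ w →
                    ¬ OnCommonGeodesic L u v w
      no-geodesic _ _ _ u≢v _ _ (_ , _ , [] , _ , ou , ov , _) =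
        u≢v (trans (onWalk₀ ou) (sym (onWalk₀ ov)))
      no-geodesic _ _ _ u≢v v≢w u≢w (_ , _ , (_ ∷ []) , _ , ou , ov , ow) =
        no-three-among-two u≢v v≢w u≢w (onWalk₁ ou) (onWalk₁ ov) (onWalk₁ ow)
      no-geodesic uS vS wS u≢v v≢w u≢w
                  (x , y , (xm ∷ my ∷ []) , shortest , ou , ov , ow) with x ≟ₑ y
      ... | yes refl = ℕP.<-irrefl refl (ℕP.≤-trans (shortest []) z≤n)
      ... | no x≢y = ℕP.<-irrefl refl (shortest (meet⇒adj x≢y xy ∷ []))
        where
          xy : Meet x y
          xy = meet-trans
            (first-among-three uS vS wS u≢v v≢w u≢w (onWalk₂ ou) (onWalk₂ ov) (onWalk₂ ow))
            (first-among-three uS vS wS u≢v v≢w u≢w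
               (among-swap (onWalk₂ ou)) (among-swap (onWalk₂ ov)) (among-swap (onWalk₂ ow)))
            (first-among-three uS vS wS u≢v v≢w u≢w
               (among-rotate (onWalk₂ ou)) (among-rotate (onWalk₂ ov)) (among-rotate (onWalk₂ ow)))
            (adj⇒meet xm) (adj⇒meet my)
      no-geodesic _ _ _ _ _ _ (_ , _ , (w₁ ∷ w₂ ∷ w₃ ∷ w) , shortest , _)
        with shortest≤2 {w = w₁ ∷ w₂ ∷ w₃ ∷ w} shortest
      ... | s≤s (s≤s ())

module Swap {A : Set} where
  ∈-split : ∀ xs {ys : List A} {v e} → e ∈ xs ++ v ∷ ys → e ≡ v ⊎ e ∈ xs ⊎ e ∈ ys
  ∈-split xs e∈ with ∈-++⁻ xs e∈
  ... | inj₁ e∈xs         = inj₂ (inj₁ e∈xs)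
  ... | inj₂ (here e≡v)   = inj₁ e≡v
  ... | inj₂ (there e∈ys) = inj₂ (inj₂ e∈ys)

  ∈-join : ∀ xs {ys : List A} {v e} → e ∈ xs ⊎ e ∈ ys → e ∈ xs ++ v ∷ ys
  ∈-join xs (inj₁ e∈xs) = ∈-++⁺ˡ e∈xs
  ∈-join xs (inj₂ e∈ys) = ∈-++⁺ʳ xs (there e∈ys)

  unique-∉ : ∀ xs {ys : List A} {u} → Unique (xs ++ u ∷ ys) → u ∉ xs × u ∉ ys
  unique-∉ [] (u∉ys ∷ _) = (λ ()) , λ u∈ys → All.lookup u∉ys u∈ys refl
  unique-∉ (x ∷ xs) (x∉ ∷ unique) =
    (λ { (here refl) → All.lookup x∉ (∈-insert xs) refl ; (there u∈xs) → proj₁ (unique-∉ xs unique) u∈xs })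
    , proj₂ (unique-∉ xs unique)

  ∈-swap⁺ : ∀ xs {ys : List A} {u v e} → e ∈ xs ++ u ∷ ys → e ≢ u → e ∈ xs ++ v ∷ ys
  ∈-swap⁺ xs e∈ e≢u with ∈-split xs e∈
  ... | inj₁ e≡u   = ⊥-elim (e≢u e≡u)
  ... | inj₂ e∈xys = ∈-join xs e∈xys

  ∈-swap⁻ : ∀ xs {ys : List A} {u v e} → Unique (xs ++ u ∷ ys) → e ∈ xs ++ v ∷ ys →
            e ≡ v ⊎ (e ∈ xs ++ u ∷ ys × e ≢ u)
  ∈-swap⁻ xs unique e∈ with ∈-split xs e∈
  ... | inj₁ e≡v          = inj₁ e≡v
  ... | inj₂ (inj₁ e∈xs) = inj₂ (∈-join xs (inj₁ e∈xs) , λ { refl → proj₁ (unique-∉ xs unique) e∈xs })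
  ... | inj₂ (inj₂ e∈ys) = inj₂ (∈-join xs (inj₂ e∈ys) , λ { refl → proj₂ (unique-∉ xs unique) e∈ys })

  unique-swap : ∀ xs {ys : List A} {u v} → Unique (xs ++ u ∷ ys) → v ∉ xs ++ u ∷ ys → Unique (xs ++ v ∷ ys)
  unique-swap [] (u∉ys ∷ unique) v∉ = All.tabulate (λ w∈ys v≡w → v∉ (there (subst (_∈ _) (sym v≡w) w∈ys))) ∷ unique
  unique-swap (x ∷ xs) {ys} {u} {v} (x∉ ∷ unique) v∉ =
    All.tabulate x≢ ∷ unique-swap xs unique (λ v∈ → v∉ (there v∈))
    where
      x≢ : ∀ {w} → w ∈ xs ++ v ∷ ys → x ≢ w
      x≢ w∈ x≡w with ∈-split xs w∈
      ... | inj₁ refl  = v∉ (here (sym x≡w))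
      ... | inj₂ w∈xys = All.lookup x∉ (∈-join xs w∈xys) x≡w

  length-swap : ∀ xs {ys : List A} {u v} → length (xs ++ u ∷ ys) ≡ length (xs ++ v ∷ ys)
  length-swap xs = trans (length-++ xs) (sym (length-++ xs))

module Tours (G : Graph) where
  open Graph G using (V)

  data Moves : List V → List V → List (List V) → Set where
    []  : ∀ {C} → Moves C C []
    _∷_ : ∀ {C C′ D cs} → LegalMove G C C′ → Moves C′ D cs → Moves C D (C ∷ cs)

  moves-++ : ∀ {C D F cs ds} → Moves C D cs → Moves D F ds → Moves C F (cs ++ ds)
  moves-++ []       ms = ms
  moves-++ (m ∷ ms) ms′ = m ∷ moves-++ ms ms′

  moves⇒run : ∀ {C D cs} → Moves C D cs → Run G C (cs ++ D ∷ [])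
  moves⇒run []       = stop
  moves⇒run (m ∷ ms) = step m (moves⇒run ms)

  moves-start : ∀ {C D cs} → Moves C D cs → C ∈ cs ++ D ∷ []
  moves-start []      = here refl
  moves-start (_ ∷ _) = here refl

  run-invariant : (P : List V → Set) → (∀ {C C′} → P C → LegalMove G C C′ → P C′) →
                  ∀ {S cs} → P S → Run G S cs → ∀ {C} → C ∈ cs → P C
  run-invariant P preserved PS stop          (here refl) = PS
  run-invariant P preserved PS (step _ _)    (here refl) = PS
  run-invariant P preserved PS (step move r) (there C∈)  = run-invariant P preserved (preserved PS move) r C∈

  Visits : List (List V) → V → Set
  Visits cs v = ∃ λ C → C ∈ cs × v ∈ C

  Tour : List V → List V → (V → Set) → Set
  Tour C D W = ∃ λ cs → Moves C D cs × (∀ {v} → W v → Visits (cs ++ D ∷ []) v)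

  tour-ends : ∀ {C D cs} → Moves C D cs → Tour C D (λ v → v ∈ C ⊎ v ∈ D)
  tour-ends {C} {D} {cs} ms = cs , ms , visits
    where
      visits : ∀ {v} → v ∈ C ⊎ v ∈ D → Visits (cs ++ D ∷ []) v
      visits (inj₁ v∈C) = C , moves-start ms , v∈C
      visits (inj₂ v∈D) = D , ∈-++⁺ʳ cs (here refl) , v∈D

  tour-weaken : ∀ {C D W W′} → Tour C D W → (∀ {v} → W′ v → W v) → Tour C D W′
  tour-weaken (cs , ms , visits) W′⊆W = cs , ms , λ w → visits (W′⊆W w)

  tour-++ : ∀ {C D F W₁ W₂} → Tour C D W₁ → Tour D F W₂ → Tour C F (λ v → W₁ v ⊎ W₂ v)
  tour-++ {F = F} {W₁} {W₂} (cs , ms , visits₁) (ds , ms′ , visits₂) = cs ++ ds , moves-++ ms ms′ , visits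
    where
      later : ∀ {X} → X ∈ ds ++ F ∷ [] → X ∈ (cs ++ ds) ++ F ∷ []
      later X∈ = subst (_ ∈_) (sym (++-assoc cs ds (F ∷ []))) (∈-++⁺ʳ cs X∈)
      visits : ∀ {v} → W₁ v ⊎ W₂ v → Visits ((cs ++ ds) ++ F ∷ []) v
      visits (inj₂ w) with visits₂ w
      ... | X , X∈ , v∈X = X , later X∈ , v∈X
      visits (inj₁ w) with visits₁ w
      ... | X , X∈ , v∈X with ∈-++⁻ cs X∈
      ...   | inj₁ X∈cs        = X , ∈-++⁺ˡ (∈-++⁺ˡ X∈cs) , v∈X
      ...   | inj₂ (here refl) = X , later (moves-start ms′) , v∈X

module Stars {n : ℕ} where
  open Edges {n}
  open LineGraph {n}
  open Swap {Edge}
  open Tours L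

  Off : Fin n → Fin n → Fin n → Set
  Off a b l = l ≢ a × l ≢ b

  record TwoStars (C : List Edge) (a : Fin n) (A : Fin n → Set) (b : Fin n) (B : Fin n → Set) : Set where
    field
      a≢b    : a ≢ b
      A-off  : ∀ {l} → A l → Off a b l
      B-off  : ∀ {l} → B l → Off a b l
      A∩B    : ∀ {l} → A l → ¬ B l
      unique : Unique C
      has-a  : ∀ {l} → A l → HasEdge C a l
      has-b  : ∀ {l} → B l → HasEdge C b l
      spoke  : ∀ {e} → e ∈ C → ∃ λ l → (A l × e ∋ a × e ∋ l) ⊎ (B l × e ∋ b × e ∋ l)

  module _ {C a A b B} (s : TwoStars C a A b B) where
    open TwoStars s

    leaf-spoke : ∀ {e x} → e ∈ C → e ∋ x → Off a b x → (A x × e ∋ a) ⊎ (B x × e ∋ b)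
    leaf-spoke e∈ ex (x≢a , x≢b) with spoke e∈
    ... | l , inj₁ (Al , ea , el) with ∋-either (≢-sym (proj₁ (A-off Al))) ea el ex
    ...   | inj₁ x≡a  = ⊥-elim (x≢a x≡a)
    ...   | inj₂ refl = inj₁ (Al , ea)
    leaf-spoke e∈ ex (x≢a , x≢b) | l , inj₂ (Bl , eb , el) with ∋-either (≢-sym (proj₂ (B-off Bl))) eb el ex
    ...   | inj₁ x≡b  = ⊥-elim (x≢b x≡b)
    ...   | inj₂ refl = inj₂ (Bl , eb)

    leaf-unique : ∀ {e f x} → e ∈ C → f ∈ C → e ∋ x → f ∋ x → Off a b x → e ≡ f
    leaf-unique e∈ f∈ ex fx off@(x≢a , x≢b) with leaf-spoke e∈ ex off | leaf-spoke f∈ fx off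
    ... | inj₁ (_ , ea)  | inj₁ (_ , fa)  = ∋-unique (≢-sym x≢a) ea ex fa fx
    ... | inj₂ (_ , eb)  | inj₂ (_ , fb)  = ∋-unique (≢-sym x≢b) eb ex fb fx
    ... | inj₁ (Ax , _)  | inj₂ (Bx , _)  = ⊥-elim (A∩B Ax Bx)
    ... | inj₂ (Bx , _)  | inj₁ (Ax , _)  = ⊥-elim (A∩B Ax Bx)

    ∌-both-centers : ∀ {e} → e ∈ C → e ∋ a → e ∋ b → ⊥
    ∌-both-centers e∈ ea eb with spoke e∈
    ... | l , inj₁ (Al , _ , el) =
      ∌-third (≢-sym (proj₁ (A-off Al))) ea el (≢-sym a≢b) (≢-sym (proj₂ (A-off Al))) eb
    ... | l , inj₂ (Bl , _ , el) =
      ∌-third (≢-sym (proj₂ (B-off Bl))) eb el a≢b (≢-sym (proj₁ (B-off Bl))) ea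

    meet-at-center : ∀ {e f} → e ∈ C → f ∈ C → Meet e f → e ≡ f ⊎ (e ∋ a × f ∋ a) ⊎ (e ∋ b × f ∋ b)
    meet-at-center e∈ f∈ (x , ex , fx) with x ≟ a | x ≟ b
    ... | yes refl | _        = inj₂ (inj₁ (ex , fx))
    ... | no _     | yes refl = inj₂ (inj₂ (ex , fx))
    ... | no x≢a   | no x≢b   = inj₁ (leaf-unique e∈ f∈ ex fx (x≢a , x≢b))

    twoStars-gp : IsGeneralPosition L C
    twoStars-gp = meet-trans⇒gp unique meet-trans
      where
        meet-trans : MeetTransitive C
        meet-trans e∈ f∈ g∈ ef fg with meet-at-center e∈ f∈ ef | meet-at-center f∈ g∈ fg
        ... | inj₁ refl            | _                    = fg
        ... | _                    | inj₁ refl            = ef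
        ... | inj₂ (inj₁ (ea , _)) | inj₂ (inj₁ (_ , ga)) = a , ea , ga
        ... | inj₂ (inj₂ (eb , _)) | inj₂ (inj₂ (_ , gb)) = b , eb , gb
        ... | inj₂ (inj₁ (_ , fa)) | inj₂ (inj₂ (fb , _)) = ⊥-elim (∌-both-centers f∈ fa fb)
        ... | inj₂ (inj₂ (_ , fb)) | inj₂ (inj₁ (fa , _)) = ⊥-elim (∌-both-centers f∈ fa fb)

  swap-stars : ∀ {C a A b B} → TwoStars C a A b B → TwoStars C b B a A
  swap-stars s = record
    { a≢b = ≢-sym a≢b ; A-off = Prod.swap ∘ B-off ; B-off = Prod.swap ∘ A-off ; A∩B = λ Bl Al → A∩B Al Bl
    ; unique = unique ; has-a = has-b ; has-b = has-a ; spoke = λ e∈ → map₂ Sum.swap (spoke e∈) }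
    where open TwoStars s

  relabel : ∀ {C a A b B A′ B′} → TwoStars C a A b B →
            (∀ {l} → A l → A′ l) → (∀ {l} → A′ l → A l) → (∀ {l} → B l → B′ l) → (∀ {l} → B′ l → B l) →
            TwoStars C a A′ b B′
  relabel s A⇒ ⇒A B⇒ ⇒B = record
    { a≢b = a≢b ; A-off = A-off ∘ ⇒A ; B-off = B-off ∘ ⇒B ; A∩B = λ A′l B′l → A∩B (⇒A A′l) (⇒B B′l)
    ; unique = unique ; has-a = has-a ∘ ⇒A ; has-b = has-b ∘ ⇒B
    ; spoke = λ e∈ → map₂ (Sum.map (map₁ A⇒) (map₁ B⇒)) (spoke e∈) }
    where open TwoStars s

  -- the only spoke {a, x} of the star at a, read as the spoke of a star at x
  recenter : ∀ {C a A b B x} → TwoStars C a A b B → A x → (∀ {l} → A l → l ≡ x) → TwoStars C x (_≡ a) b B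
  recenter {C} {a} {A} {b} {B} {x} s Ax only-x = record
    { a≢b = proj₂ (A-off Ax)
    ; A-off = λ { refl → ≢-sym (proj₁ (A-off Ax)) , a≢b }
    ; B-off = λ Bl → (λ { refl → A∩B Ax Bl }) , proj₂ (B-off Bl)
    ; A∩B = λ { refl Ba → proj₁ (B-off Ba) refl }
    ; unique = unique
    ; has-a = λ { refl → map₂ (map₂ Prod.swap) (has-a Ax) }
    ; has-b = has-b
    ; spoke = spoke′ }
    where
      open TwoStars s
      spoke′ : ∀ {e} → e ∈ C → ∃ λ l → (l ≡ a × e ∋ x × e ∋ l) ⊎ (B l × e ∋ b × e ∋ l)
      spoke′ e∈ with spoke e∈
      ... | l , inj₁ (Al , ea , el) rewrite only-x Al = a , inj₁ (refl , el , ea)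
      ... | l , inj₂ Bl-spoke = l , inj₂ Bl-spoke

  transfer : ∀ {C a A b B l} → TwoStars C a A b B → A l →
             ∃ λ C′ → LegalMove L C C′ × TwoStars C′ a (λ x → A x × x ≢ l) b (λ x → B x ⊎ x ≡ l)
  transfer {C} {a} {A} {b} {B} {l} s Al with TwoStars.has-a s Al
  ... | u , u∈ , ua , ul with ∈-∃++ u∈
  ... | xs , ys , refl = xs ++ v ∷ ys , (xs , ys , u , v , refl , refl , u-adj-v , v∉ , twoStars-gp s′) , s′
    where
      open TwoStars s
      l≢a : l ≢ a
      l≢a = proj₁ (A-off Al)
      l≢b : l ≢ b
      l≢b = proj₂ (A-off Al)
      v : Edge
      v = edge b l (≢-sym l≢b)
      vb : v ∋ b
      vb = edge-∋ˡ (≢-sym l≢b)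
      vl : v ∋ l
      vl = edge-∋ʳ (≢-sym l≢b)
      ≢u : ∀ {e x} → e ∋ x → x ≢ a → x ≢ l → e ≢ u
      ≢u ex x≢a x≢l refl = ∌-third (≢-sym l≢a) ua ul x≢a x≢l ex
      u-adj-v : Adj u v
      u-adj-v = meet⇒adj (≢-sym (≢u vb (≢-sym a≢b) (≢-sym l≢b))) (l , ul , vl)
      v∉ : v ∉ xs ++ u ∷ ys
      v∉ v∈ with leaf-spoke s v∈ vl (l≢a , l≢b)
      ... | inj₁ (_ , va) = ∌-third (≢-sym l≢b) vb vl a≢b (≢-sym l≢a) va
      ... | inj₂ (Bl , _) = A∩B Al Bl
      spoke′ : ∀ {e} → e ∈ xs ++ v ∷ ys →
               ∃ λ y → ((A y × y ≢ l) × e ∋ a × e ∋ y) ⊎ ((B y ⊎ y ≡ l) × e ∋ b × e ∋ y)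
      spoke′ e∈ with ∈-swap⁻ xs unique e∈
      ... | inj₁ refl = l , inj₂ (inj₂ refl , vb , vl)
      ... | inj₂ (e∈C , e≢u) with spoke e∈C
      ...   | y , inj₁ (Ay , ea , ey) = y , inj₁ ((Ay , λ { refl → e≢u (∋-unique (≢-sym l≢a) ea ey ua ul) }) , ea , ey)
      ...   | y , inj₂ (By , eb , ey) = y , inj₂ (inj₁ By , eb , ey)
      s′ : TwoStars (xs ++ v ∷ ys) a (λ x → A x × x ≢ l) b (λ x → B x ⊎ x ≡ l)
      s′ = record
        { a≢b = a≢b
        ; A-off = A-off ∘ proj₁
        ; B-off = λ { (inj₁ Bx) → B-off Bx ; (inj₂ refl) → l≢a , l≢b }
        ; A∩B = λ { (Ax , _) (inj₁ Bx) → A∩B Ax Bx ; (_ , x≢l) (inj₂ x≡l) → x≢l x≡l }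
        ; unique = unique-swap xs unique v∉
        ; has-a = λ { (Ax , x≢l) → let (e , e∈ , ea , ex) = has-a Ax in
                        e , ∈-swap⁺ xs e∈ (≢u ex (proj₁ (A-off Ax)) x≢l) , ea , ex }
        ; has-b = λ { (inj₁ Bx) → let (e , e∈ , eb , ex) = has-b Bx in
                        e , ∈-swap⁺ xs e∈ (≢u eb (≢-sym a≢b) (≢-sym l≢b)) , eb , ex
                    ; (inj₂ refl) → v , ∈-insert xs , vb , vl }
        ; spoke = spoke′ }

  sweep : ∀ {C a A b B} → TwoStars C a A b B → (ls : List (Fin n)) → Unique ls → (∀ {l} → l ∈ ls → A l) →
          ∃₂ λ D cs → Moves C D cs × TwoStars D a (λ x → A x × x ∉ ls) b (λ x → B x ⊎ x ∈ ls)
  sweep s [] _ _ = _ , [] , [] , relabel s (_, λ ()) proj₁ inj₁ λ { (inj₁ Bx) → Bx }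
  sweep {A = A} {B = B} s (l ∷ ls) (l∉ls ∷ unique) ls⊆A with transfer s (ls⊆A (here refl))
  ... | C₁ , move , s₁ with sweep s₁ ls unique (λ x∈ → ls⊆A (there x∈) , λ { refl → All.lookup l∉ls x∈ refl })
  ... | D , cs , moves , s₂ = D , _ , move ∷ moves , relabel s₂ A⇒ ⇒A B⇒ ⇒B
    where
      A⇒ : ∀ {x} → (A x × x ≢ l) × x ∉ ls → A x × x ∉ l ∷ ls
      A⇒ ((Ax , x≢l) , x∉ls) = Ax , λ { (here x≡l) → x≢l x≡l ; (there x∈ls) → x∉ls x∈ls }
      ⇒A : ∀ {x} → A x × x ∉ l ∷ ls → (A x × x ≢ l) × x ∉ ls
      ⇒A (Ax , x∉) = (Ax , x∉ ∘ here) , x∉ ∘ there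
      B⇒ : ∀ {x} → (B x ⊎ x ≡ l) ⊎ x ∈ ls → B x ⊎ x ∈ l ∷ ls
      B⇒ (inj₁ (inj₁ Bx))  = inj₁ Bx
      B⇒ (inj₁ (inj₂ x≡l)) = inj₂ (here x≡l)
      B⇒ (inj₂ x∈ls)       = inj₂ (there x∈ls)
      ⇒B : ∀ {x} → B x ⊎ x ∈ l ∷ ls → (B x ⊎ x ≡ l) ⊎ x ∈ ls
      ⇒B (inj₁ Bx)           = inj₁ (inj₁ Bx)
      ⇒B (inj₂ (here x≡l))   = inj₁ (inj₂ x≡l)
      ⇒B (inj₂ (there x∈ls)) = inj₂ x∈ls

  sweep-all : ∀ {C a A b B} → TwoStars C a A b B → Decidable A →
              ∃₂ λ D cs → Moves C D cs × TwoStars D a (λ _ → ⊥) b (λ x → B x ⊎ A x)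
  sweep-all {A = A} s A? with sweep s (filter A? (allFin n)) (Unique.filter⁺ A? (Unique.allFin⁺ n)) (proj₂ ∘ ∈-filter⁻ A? {xs = allFin n})
  ... | D , cs , moves , s′ =
    D , cs , moves , relabel s′ (λ (Ax , x∉) → x∉ (enumerated Ax)) ⊥-elim
                                (Sum.map₂ (proj₂ ∘ ∈-filter⁻ A? {xs = allFin n})) (Sum.map₂ enumerated)
    where
      enumerated : ∀ {x} → A x → x ∈ filter A? (allFin n)
      enumerated Ax = ∈-filter⁺ A? (∈-allFin _) Ax

module Schedule {n : ℕ} (z : Fin n) where
  open Edges {n}
  open LineGraph {n}
  open Tours L
  open Stars {n}

  Star : List Edge → Fin n → Set
  Star C c = TwoStars C c (Off c z) z (λ _ → ⊥)

  off? : ∀ c → Decidable (Off c z)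
  off? c x = ¬? (x ≟ c) ×-dec ¬? (x ≟ z)

  Swept : Fin n → Edge → Set
  Swept c v = ∃ λ l → Off c z l × ((v ∋ c × v ∋ l) ⊎ (v ∋ z × v ∋ l))

  sweep-round : ∀ {C c} → Star C c → ∃ λ D → Tour C D (Swept c) × TwoStars D c (λ _ → ⊥) z (Off c z)
  sweep-round {C} {c} s with sweep-all s (off? c)
  ... | D , cs , moves , s′ = D , tour-weaken (tour-ends moves) visited , s″
    where
      s″ : TwoStars D c (λ _ → ⊥) z (Off c z)
      s″ = relabel s′ id id (λ { (inj₂ off) → off }) inj₂
      visited : ∀ {v} → Swept c v → v ∈ C ⊎ v ∈ D
      visited (l , off , inj₁ (vc , vl)) = inj₁ (has⇒∈ (≢-sym (proj₁ off)) (TwoStars.has-a s off) vc vl)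
      visited (l , off , inj₂ (vz , vl)) = inj₂ (has⇒∈ (≢-sym (proj₂ off)) (TwoStars.has-b s″ off) vz vl)

  -- move {z, c′} to {c, c′}, regard it as the spoke of the new star at c′, then sweep z's spokes to c′
  change-center : ∀ {D c c′} → TwoStars D c (λ _ → ⊥) z (Off c z) → Off c z c′ →
                  ∃ λ F → Tour D F (λ _ → ⊥) × Star F c′
  change-center {D} {c} {c′} s off′ with transfer (swap-stars s) off′
  ... | D₁ , move , s₁ with sweep-all (swap-stars (recenter (swap-stars s₁) (inj₂ refl) λ { (inj₂ l≡c′) → l≡c′ }))
                                      (λ x → off? c x ×-dec ¬? (x ≟ c′))
  ... | F , cs , moves , s₂ = F , (D ∷ cs , move ∷ moves , λ ()) , relabel (swap-stars s₂) A⇒ ⇒A id id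
    where
      A⇒ : ∀ {x} → x ≡ c ⊎ (Off c z x × x ≢ c′) → Off c′ z x
      A⇒ (inj₁ refl)               = ≢-sym (proj₁ off′) , TwoStars.a≢b s
      A⇒ (inj₂ ((_ , x≢z) , x≢c′)) = x≢c′ , x≢z
      ⇒A : ∀ {x} → Off c′ z x → x ≡ c ⊎ (Off c z x × x ≢ c′)
      ⇒A {x} (x≢c′ , x≢z) with x ≟ c
      ... | yes x≡c = inj₁ x≡c
      ... | no x≢c  = inj₂ ((x≢c , x≢z) , x≢c′)

  tour-centers : ∀ {C} c (cs : List (Fin n)) → (∀ {x} → x ∈ cs → x ≢ z) → Unique (c ∷ cs) → Star C c →
                 ∃ λ D → Tour C D (λ v → ∃ λ x → x ∈ c ∷ cs × Swept x v)
  tour-centers c [] _ _ s with sweep-round s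
  ... | D , tour , _ = D , tour-weaken tour λ { (x , here refl , swept) → swept }
  tour-centers c (c′ ∷ cs) ≢z (c∉ ∷ unique) s with sweep-round s
  ... | D , tour₁ , s₁ with change-center s₁ (≢-sym (All.lookup c∉ (here refl)) , ≢z (here refl))
  ... | F , tour₂ , s₂ with tour-centers c′ cs (≢z ∘ there) unique s₂
  ... | H , tour₃ = H , tour-weaken (tour-++ (tour-++ tour₁ tour₂) tour₃) split
    where
      split : ∀ {v} → (∃ λ x → x ∈ c ∷ c′ ∷ cs × Swept x v) →
              (Swept c v ⊎ ⊥) ⊎ (∃ λ x → x ∈ c′ ∷ cs × Swept x v)
      split (x , here refl , swept) = inj₁ (inj₁ swept)
      split (x , there x∈ , swept)  = inj₂ (x , x∈ , swept)

module LowerBound (k : ℕ) where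
  n : ℕ
  n = suc (suc (suc (suc k)))

  open Edges {n}
  open LineGraph {n}
  open Tours L
  open Stars {n}
  open Schedule {n} Fin.zero

  1F 2F : Fin n
  1F = Fin.suc Fin.zero
  2F = Fin.suc (Fin.suc Fin.zero)

  leaf₀ : Fin (suc (suc k)) → Fin n
  leaf₀ i = Fin.suc (Fin.suc i)

  1≢leaf₀ : ∀ i → 1F ≢ leaf₀ i
  1≢leaf₀ i ()

  spoke₀ : Fin (suc (suc k)) → Edge
  spoke₀ i = edge 1F (leaf₀ i) (1≢leaf₀ i)

  C₀ : List Edge
  C₀ = tabulate spoke₀

  star₀ : Star C₀ 1F
  star₀ = record
    { a≢b = λ ()
    ; A-off = id
    ; B-off = λ ()
    ; A∩B = λ _ ()
    ; unique = Unique.tabulate⁺ spoke₀-injective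
    ; has-a = has-a
    ; has-b = λ ()
    ; spoke = spoke }
    where
      spoke₀-injective : ∀ {i j} → spoke₀ i ≡ spoke₀ j → i ≡ j
      spoke₀-injective {i} {j} eq
        with ∋-either (1≢leaf₀ j) (edge-∋ˡ (1≢leaf₀ j)) (edge-∋ʳ (1≢leaf₀ j))
                      (subst (_∋ leaf₀ i) eq (edge-∋ʳ (1≢leaf₀ i)))
      ... | inj₁ ()
      ... | inj₂ leaf≡leaf = suc-injective (suc-injective leaf≡leaf)
      has-a : ∀ {l} → Off 1F Fin.zero l → HasEdge C₀ 1F l
      has-a {Fin.zero}             (_ , l≢0) = ⊥-elim (l≢0 refl)
      has-a {Fin.suc Fin.zero}     (l≢1 , _) = ⊥-elim (l≢1 refl)
      has-a {Fin.suc (Fin.suc i)} _         = spoke₀ i , ∈-tabulate⁺ {f = spoke₀} i , edge-∋ˡ (1≢leaf₀ i) , edge-∋ʳ (1≢leaf₀ i)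
      spoke : ∀ {e} → e ∈ C₀ →
              ∃ λ l → (Off 1F Fin.zero l × e ∋ 1F × e ∋ l) ⊎ (⊥ × e ∋ Fin.zero × e ∋ l)
      spoke e∈ with ∈-tabulate⁻ {f = spoke₀} e∈
      ... | i , refl = leaf₀ i , inj₁ ((≢-sym (1≢leaf₀ i) , λ ()) , edge-∋ˡ (1≢leaf₀ i) , edge-∋ʳ (1≢leaf₀ i))

  centers : List (Fin n)
  centers = tabulate Fin.suc

  every-edge-swept : ∀ v → ∃ λ x → x ∈ centers × Swept x v
  every-edge-swept v with lo v in lo≡ | lo<hi v
  ... | Fin.suc i | lo<hi′ = Fin.suc i , ∈-tabulate⁺ {f = Fin.suc} i , hi v , (hi≢lo , hi≢0) , inj₁ (lo∋ lo≡ , ∋-hi v)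
    where
      hi≢lo : hi v ≢ Fin.suc i
      hi≢lo hi≡ = lo≢hi v (trans lo≡ (sym hi≡))
      hi≢0 : hi v ≢ Fin.zero
      hi≢0 hi≡0 with subst (Fin.suc i <_) hi≡0 lo<hi′
      ... | ()
  ... | Fin.zero | _ with hi v ≟ 1F
  ...   | no hi≢1  = 1F , here refl , hi v , (hi≢1 , hi≢0) , inj₂ (lo∋ lo≡ , ∋-hi v)
    where
      hi≢0 : hi v ≢ Fin.zero
      hi≢0 hi≡0 = lo≢hi v (trans lo≡ (sym hi≡0))
  ...   | yes hi≡1 = 2F , ∈-tabulate⁺ {f = Fin.suc} (Fin.suc Fin.zero) , 1F , ((λ ()) , (λ ())) , inj₂ (lo∋ lo≡ , hi∋ hi≡1)

  -- opaque: otherwise checking lower-bound unfolds the whole schedule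
  opaque
    tour₀ : ∃ λ D → Tour C₀ D (λ v → ∃ λ x → x ∈ centers × Swept x v)
    tour₀ = tour-centers 1F later-centers nonzero (Unique.tabulate⁺ suc-injective) star₀
      where
        later-centers : List (Fin n)
        later-centers = tabulate (Fin.suc ∘ Fin.suc)
        nonzero : ∀ {x} → x ∈ later-centers → x ≢ Fin.zero
        nonzero x∈ with ∈-tabulate⁻ {f = Fin.suc ∘ Fin.suc} x∈
        ... | _ , refl = λ ()

  lower-bound : ∃ λ S → IsMobileGP L S × length S ≡ n ∸ 2
  lower-bound =
    let (D , cs , moves , visits) = tour₀ in
    C₀ , (twoStars-gp star₀ , cs ++ D ∷ [] , moves⇒run moves , λ v → visits (every-edge-swept v))
       , length-tabulate spoke₀

module PrivatePoints {n : ℕ} {S : List (EdgeK n)} (gp : IsGeneralPosition (LineK n) S) where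
  open Edges {n}
  open LineGraph {n}

  meet-trans : MeetTransitive S
  meet-trans = gp⇒meet-trans gp

  Shared : Edge → Fin n → Set
  Shared e x = ∃ λ f → f ∈ S × f ≢ e × f ∋ x

  shared? : ∀ e x → Dec (Shared e x)
  shared? e x = ∃∈? (λ f → ¬? (f ≟ₑ e) ×-dec f ∋? x) S

  shared-endpoint : ∀ {e x} → Shared e (lo e) → Shared e (hi e) → e ∋ x → Shared e x
  shared-endpoint lo-shared _ (lo∋ refl) = lo-shared
  shared-endpoint _ hi-shared (hi∋ refl) = hi-shared

  -- φ e below is an endpoint of e on no other edge of S when there is one; the edges xy, xz, yz of a
  -- triangle x < y < z of S have none and are sent to y, x, z, told apart by xz being the only Shortcut.
  Shortcut : Edge → Set
  Shortcut e = ∃ λ f → f ∈ S × f ≢ e × lo f ≡ lo e × hi f < hi e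

  shortcut? : ∀ e → Dec (Shortcut e)
  shortcut? e = ∃∈? (λ f → ¬? (f ≟ₑ e) ×-dec (lo f ≟ lo e) ×-dec (hi f <? hi e)) S

  data TrianglePoint (e : Edge) (x : Fin n) : Set where
    at-lo : Shortcut e → lo e ≡ x → TrianglePoint e x
    at-hi : ¬ Shortcut e → hi e ≡ x → TrianglePoint e x

  data PrivatePoint (e : Edge) (x : Fin n) : Set where
    hi-unshared : ¬ Shared e (hi e) → hi e ≡ x → PrivatePoint e x
    lo-unshared : Shared e (hi e) → ¬ Shared e (lo e) → lo e ≡ x → PrivatePoint e x
    in-triangle : Shared e (lo e) → Shared e (hi e) → TrianglePoint e x → PrivatePoint e x

  private-point : ∀ e → ∃ (PrivatePoint e)
  private-point e with shared? e (hi e) | shared? e (lo e) | shortcut? e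
  ... | no hi-free | _          | _         = hi e , hi-unshared hi-free refl
  ... | yes hi-sh  | no lo-free | _         = lo e , lo-unshared hi-sh lo-free refl
  ... | yes hi-sh  | yes lo-sh  | yes short = lo e , in-triangle lo-sh hi-sh (at-lo short refl)
  ... | yes hi-sh  | yes lo-sh  | no ¬short = hi e , in-triangle lo-sh hi-sh (at-hi ¬short refl)

  φ : Edge → Fin n
  φ e = proj₁ (private-point e)

  φ-view : ∀ e → PrivatePoint e (φ e)
  φ-view e = proj₂ (private-point e)

  private-∋ : ∀ {e x} → PrivatePoint e x → e ∋ x
  private-∋ (hi-unshared _ hi≡)             = hi∋ hi≡
  private-∋ (lo-unshared _ _ lo≡)           = lo∋ lo≡
  private-∋ (in-triangle _ _ (at-lo _ lo≡)) = lo∋ lo≡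
  private-∋ (in-triangle _ _ (at-hi _ hi≡)) = hi∋ hi≡

  φ-∋ : ∀ e → e ∋ φ e
  φ-∋ e = private-∋ (φ-view e)

  Triangular : Edge → Set
  Triangular e = Shared e (lo e) × Shared e (hi e)

  unshared-or-triangle : ∀ {e x} → PrivatePoint e x → ¬ Shared e x ⊎ (Triangular e × TrianglePoint e x)
  unshared-or-triangle (hi-unshared free refl)   = inj₁ free
  unshared-or-triangle (lo-unshared _ free refl) = inj₁ free
  unshared-or-triangle (in-triangle lo hi t)     = inj₂ ((lo , hi) , t)

  closing-edge : ∀ {e e′ z} → e ∈ S → e′ ∈ S → e ≢ e′ → e ∋ z → e′ ∋ z → Shared e (other e z) →
                 ∃ λ g → g ∈ S × g ≢ e × g ∋ other e z × g ∋ other e′ z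
  closing-edge {e} {e′} {z} e∈ e′∈ e≢e′ ez e′z (g , g∈ , g≢e , gw)
    with meet-trans g∈ e∈ e′∈ (other e z , gw , ∋-other e z) (z , ez , e′z)
  ... | r , gr , e′r with ∋-either (other-≢ e′z) e′z (∋-other e′ z) e′r
  ...   | inj₁ refl = ⊥-elim (g≢e (∋-unique (other-≢ ez) gr gw ez (∋-other e z)))
  ...   | inj₂ refl = g , g∈ , g≢e , gw , gr

  triangle-unique : ∀ {e e′ h z} → e ∈ S → e′ ∈ S → h ∈ S → e ≢ e′ → e ∋ z → e′ ∋ z → Shared e (other e z) →
                    h ≢ e → h ∋ z → h ≡ e′
  triangle-unique {e} {e′} {h} {z} e∈ e′∈ h∈ e≢e′ ez e′z far-shared h≢e hz
    with closing-edge e∈ e′∈ e≢e′ ez e′z far-shared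
  ... | g , g∈ , g≢e , gw , gw′ with meet-trans h∈ e∈ g∈ (z , hz , ez) (other e z , ∋-other e z , gw)
  ...   | r , hr , gr with ∋-either (other-distinct e≢e′ ez e′z) gw gw′ gr
  ...     | inj₁ refl = ⊥-elim (h≢e (∋-unique (other-≢ ez) hz hr ez (∋-other e z)))
  ...     | inj₂ refl = ∋-unique (other-≢ e′z) hz hr e′z (∋-other e′ z)

  shortcut-partner : ∀ {e e′ z} → e ∈ S → e′ ∈ S → e ≢ e′ → Triangular e → e′ ∋ z →
                     Shortcut e → lo e ≡ z → lo e′ ≡ z × hi e′ < hi e
  shortcut-partner {e} {z = z} e∈ e′∈ e≢e′ (lo-sh , hi-sh) e′z (f , f∈ , f≢e , lo-f , hi-f<) lo≡z
    with triangle-unique e∈ e′∈ f∈ e≢e′ (lo∋ lo≡z) e′z (shared-endpoint lo-sh hi-sh (∋-other e z))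
                         f≢e (lo∋ (trans lo-f lo≡z))
  ... | refl = trans lo-f lo≡z , hi-f<

  ordered-shortcut : ∀ {e e′ z} → e ∈ S → e′ ∈ S → e ≢ e′ → Triangular e →
                     hi e ≡ z → hi e′ ≡ z → lo e < lo e′ → Shortcut e
  ordered-shortcut {e} {e′} {z} e∈ e′∈ e≢e′ (lo-sh , hi-sh) hi≡z hi′≡z lo<lo′
    with closing-edge e∈ e′∈ e≢e′ (hi∋ hi≡z) (hi∋ hi′≡z) (shared-endpoint lo-sh hi-sh (∋-other e z))
  ... | g , g∈ , g≢e , g∋ , g∋′ with ∋-ordered (subst (g ∋_) (other-lo hi≡z) g∋)
                                                (subst (g ∋_) (other-lo hi′≡z) g∋′) lo<lo′
  ...   | lo-g , hi-g = g , g∈ , g≢e , lo-g , subst₂ _<_ (sym hi-g) (trans hi′≡z (sym hi≡z)) (lo<hi e′)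

  triangle-points-distinct : ∀ {e e′ z} → e ∈ S → e′ ∈ S → e ≢ e′ → Triangular e → Triangular e′ →
                             TrianglePoint e z → TrianglePoint e′ z → ⊥
  triangle-points-distinct e∈ e′∈ e≢e′ tri tri′ (at-lo short lo≡z) (at-lo short′ lo′≡z) =
    <-asym (proj₂ (shortcut-partner e∈ e′∈ e≢e′ tri (lo∋ lo′≡z) short lo≡z))
           (proj₂ (shortcut-partner e′∈ e∈ (≢-sym e≢e′) tri′ (lo∋ lo≡z) short′ lo′≡z))
  triangle-points-distinct {e′ = e′} e∈ e′∈ e≢e′ tri _ (at-lo short lo≡z) (at-hi _ hi′≡z) =
    lo≢hi e′ (trans (proj₁ (shortcut-partner e∈ e′∈ e≢e′ tri (hi∋ hi′≡z) short lo≡z)) (sym hi′≡z))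
  triangle-points-distinct {e} e∈ e′∈ e≢e′ _ tri′ (at-hi _ hi≡z) (at-lo short′ lo′≡z) =
    lo≢hi e (trans (proj₁ (shortcut-partner e′∈ e∈ (≢-sym e≢e′) tri′ (hi∋ hi≡z) short′ lo′≡z)) (sym hi≡z))
  triangle-points-distinct {e} {e′} e∈ e′∈ e≢e′ tri tri′ (at-hi ¬short hi≡z) (at-hi ¬short′ hi′≡z)
    with <-cmp (lo e) (lo e′)
  ... | tri< lo<lo′ _ _ = ¬short (ordered-shortcut e∈ e′∈ e≢e′ tri hi≡z hi′≡z lo<lo′)
  ... | tri≈ _ lo≡lo′ _ = e≢e′ (edge-≡ lo≡lo′ (trans hi≡z (sym hi′≡z)))
  ... | tri> _ _ lo′<lo = ¬short′ (ordered-shortcut e′∈ e∈ (≢-sym e≢e′) tri′ hi′≡z hi≡z lo′<lo)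

  φ-injective : ∀ {e e′} → e ∈ S → e′ ∈ S → φ e ≡ φ e′ → e ≡ e′
  φ-injective {e} {e′} e∈ e′∈ φ≡ with e ≟ₑ e′
  ... | yes e≡e′ = e≡e′
  ... | no e≢e′ with unshared-or-triangle (φ-view e) | unshared-or-triangle (φ-view e′)
  ...   | inj₁ free | _ = ⊥-elim (free (e′ , e′∈ , ≢-sym e≢e′ , subst (e′ ∋_) (sym φ≡) (φ-∋ e′)))
  ...   | _ | inj₁ free′ = ⊥-elim (free′ (e , e∈ , e≢e′ , subst (e ∋_) φ≡ (φ-∋ e)))
  ...   | inj₂ (tri , t) | inj₂ (tri′ , t′) =
    ⊥-elim (triangle-points-distinct e∈ e′∈ e≢e′ tri tri′ t
                                     (subst (TrianglePoint e′) (sym φ≡) t′))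

  Spare : Fin n → Set
  Spare x = ∀ {h} → h ∈ S → φ h ≢ x

  spare-if : ∀ {x} → (∀ {h} → h ∈ S → PrivatePoint h x → ⊥) → Spare x
  spare-if never h∈ refl = never h∈ (φ-view _)

  uncovered-spare : ∀ {x} → (∀ {e} → e ∈ S → ¬ e ∋ x) → Spare x
  uncovered-spare uncovered = spare-if λ h∈ p → uncovered h∈ (private-∋ p)

  center-spare : ∀ {e x b} → e ∈ S → e ∋ x → e ∋ b → x ≢ b → ¬ Shared e b → Shared e x → Spare x
  center-spare {e} {x} {b} e∈ ex eb x≢b leaf (e′ , e′∈ , e′≢e , e′x) =
    spare-if λ h∈ p → not-private h∈ (private-∋ p) (unshared-or-triangle p)
    where
      not-private : ∀ {h} → h ∈ S → h ∋ x → ¬ Shared h x ⊎ (Triangular h × TrianglePoint h x) → ⊥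
      not-private {h} h∈ hx view with h ≟ₑ e | view
      ... | yes refl | inj₁ free               = free (e′ , e′∈ , e′≢e , e′x)
      ... | no h≢e   | inj₁ free               = free (e , e∈ , ≢-sym h≢e , ex)
      ... | yes refl | inj₂ ((lo-sh , hi-sh) , _) = leaf (shared-endpoint lo-sh hi-sh eb)
      ... | no h≢e   | inj₂ ((lo-sh , hi-sh) , _)
        with closing-edge h∈ e∈ h≢e hx ex (shared-endpoint lo-sh hi-sh (∋-other h x))
      ...   | g , g∈ , _ , g∋ , g∋′ with ∋-either x≢b ex eb (∋-other e x)
      ...     | inj₁ other≡x = other-≢ ex (sym other≡x)
      ...     | inj₂ other≡b = leaf (g , g∈ , g≢e , subst (g ∋_) other≡b g∋′)
        where
          g≢e : g ≢ e
          g≢e refl with ∋-either x≢b ex eb g∋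
          ... | inj₁ w≡x = other-≢ hx (sym w≡x)
          ... | inj₂ w≡b = h≢e (∋-unique x≢b hx (subst (h ∋_) w≡b (∋-other h x)) ex eb)

  isolated-spare : ∀ {e} → e ∈ S → ¬ Shared e (lo e) → ¬ Shared e (hi e) → Spare (lo e)
  isolated-spare {e} e∈ lo-free hi-free = spare-if not-private
    where
      not-private : ∀ {h} → h ∈ S → PrivatePoint h (lo e) → ⊥
      not-private {h} h∈ p with h ≟ₑ e | p
      ... | no h≢e   | _                   = lo-free (h , h∈ , h≢e , private-∋ p)
      ... | yes refl | hi-unshared _ hi≡lo = lo≢hi e (sym hi≡lo)
      ... | yes refl | lo-unshared hi-sh _ _ = hi-free hi-sh
      ... | yes refl | in-triangle lo-sh _ _ = lo-free lo-sh

  leaf-spare : ∀ {e x} → e ∈ S → e ∋ x → ¬ Shared e x → ∃ λ d → Spare d × e ∋ d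
  leaf-spare {e} {x} e∈ ex leaf with shared? e (other e x)
  ... | yes center-shared =
    other e x , center-spare e∈ (∋-other e x) ex (≢-sym (other-≢ ex)) leaf center-shared , ∋-other e x
  ... | no center-free = lo e , isolated-spare e∈ (free (∋-lo e)) (free (∋-hi e)) , ∋-lo e
    where
      free : ∀ {w} → e ∋ w → ¬ Shared e w
      free ew with ∋-either (other-≢ ex) ex (∋-other e x) ew
      ... | inj₁ refl = leaf
      ... | inj₂ refl = center-free

  spare-pair-bound : ∀ {x y} → x ≢ y → Spare x → Spare y → suc (suc (length S)) ≤ n
  spare-pair-bound {x} {y} x≢y x-spare y-spare = injective⇒≤ point-injective
    where
      point : Fin (suc (suc (length S))) → Fin n
      point Fin.zero                = x
      point (Fin.suc Fin.zero)      = y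
      point (Fin.suc (Fin.suc i))   = φ (lookup S i)
      point-injective : ∀ {i j} → point i ≡ point j → i ≡ j
      point-injective {Fin.zero}              {Fin.zero}              _  = refl
      point-injective {Fin.zero}              {Fin.suc Fin.zero}      eq = ⊥-elim (x≢y eq)
      point-injective {Fin.zero}              {Fin.suc (Fin.suc j)}   eq = ⊥-elim (x-spare (∈-lookup j) (sym eq))
      point-injective {Fin.suc Fin.zero}      {Fin.zero}              eq = ⊥-elim (x≢y (sym eq))
      point-injective {Fin.suc Fin.zero}      {Fin.suc Fin.zero}      _  = refl
      point-injective {Fin.suc Fin.zero}      {Fin.suc (Fin.suc j)}   eq = ⊥-elim (y-spare (∈-lookup j) (sym eq))
      point-injective {Fin.suc (Fin.suc i)}   {Fin.zero}              eq = ⊥-elim (x-spare (∈-lookup i) eq)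
      point-injective {Fin.suc (Fin.suc i)}   {Fin.suc Fin.zero}      eq = ⊥-elim (y-spare (∈-lookup i) eq)
      point-injective {Fin.suc (Fin.suc i)}   {Fin.suc (Fin.suc j)}   eq =
        cong (Fin.suc ∘ Fin.suc) (lookup-injective (proj₁ gp) (φ-injective (∈-lookup i) (∈-lookup j) eq))

module AfterMove {n : ℕ} {xs ys : List (EdgeK n)} {u v : EdgeK n}
  (gp : IsGeneralPosition (LineK n) (xs ++ u ∷ ys)) (large : n ≤ suc (length (xs ++ u ∷ ys)))
  (u-adj-v : Graph.Adj (LineK n) u v) (v∉ : v ∉ xs ++ u ∷ ys)
  (gp′ : IsGeneralPosition (LineK n) (xs ++ v ∷ ys)) where

  open Edges {n}
  open LineGraph {n}
  open Swap {Edge}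
  open PrivatePoints gp

  S S′ : List Edge
  S  = xs ++ u ∷ ys
  S′ = xs ++ v ∷ ys

  a b c : Fin n
  a = proj₁ (adj⇒meet u-adj-v)
  b = other u a
  c = other v a

  ua : u ∋ a
  ua = proj₁ (proj₂ (adj⇒meet u-adj-v))
  va : v ∋ a
  va = proj₂ (proj₂ (adj⇒meet u-adj-v))
  ub : u ∋ b
  ub = ∋-other u a
  vc : v ∋ c
  vc = ∋-other v a
  a≢b : a ≢ b
  a≢b = other-≢ ua
  a≢c : a ≢ c
  a≢c = other-≢ va
  b≢c : b ≢ c
  b≢c b≡c = proj₁ u-adj-v (∋-unique a≢b ua ub va (subst (v ∋_) (sym b≡c) vc))

  u∈ : u ∈ S
  u∈ = ∈-insert xs
  v∈′ : v ∈ S′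
  v∈′ = ∈-insert xs
  ∈′ : ∀ {e} → e ∈ S → e ≢ u → e ∈ S′
  ∈′ e∈ e≢u = ∈-swap⁺ xs e∈ e≢u

  u∌ : ∀ {x} → x ≢ a → x ≢ b → ¬ u ∋ x
  u∌ = ∌-third a≢b ua ub

  ≢u : ∀ {e x} → e ∋ x → x ≢ a → x ≢ b → e ≢ u
  ≢u ex x≢a x≢b refl = u∌ x≢a x≢b ex

  ≢v : ∀ {e} → e ∈ S → e ≢ v
  ≢v e∈ refl = v∉ e∈

  meet-trans′ : MeetTransitive S′
  meet-trans′ = gp⇒meet-trans gp′

  no-two-spares : ∀ {x y} → x ≢ y → Spare x → Spare y → ⊥
  no-two-spares x≢y x-spare y-spare = ℕP.<-irrefl refl (ℕP.≤-trans (spare-pair-bound x≢y x-spare y-spare) large)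

  -- if a is shared, b is a leaf of u and c is uncovered: two spare points
  shared-pivot-impossible : Shared u a → ⊥
  shared-pivot-impossible (g , g∈ , g≢u , ga) =
    let (d , d-spare , ud) = leaf-spare u∈ ub b-leaf in
    no-two-spares (λ d≡c → u∌ (≢-sym a≢c) (≢-sym b≢c) (subst (u ∋_) d≡c ud)) d-spare (uncovered-spare c-uncovered)
    where
      t : Fin n
      t = other g a
      gt : g ∋ t
      gt = ∋-other g a
      a≢t : a ≢ t
      a≢t = other-≢ ga
      t≢b : t ≢ b
      t≢b t≡b = g≢u (∋-unique a≢b ga (subst (g ∋_) t≡b gt) ua ub)
      t≢c : t ≢ c
      t≢c t≡c = ≢v g∈ (∋-unique a≢c ga (subst (g ∋_) t≡c gt) va vc)
      b-leaf : ¬ Shared u b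
      b-leaf (h , h∈ , h≢u , hb) with meet-trans h∈ u∈ g∈ (b , hb , ub) (a , ua , ga)
      ... | r , hr , gr with ∋-either a≢t ga gt gr
      ...   | inj₁ refl = h≢u (∋-unique a≢b hr hb ua ub)
      ...   | inj₂ refl =
        ¬meet-apart a≢c (≢-sym t≢b) va vc hb hr a≢b a≢t (≢-sym b≢c) (≢-sym t≢c)
          (meet-trans′ v∈′ (∈′ g∈ g≢u) (∈′ h∈ h≢u) (a , va , ga) (t , gt , hr))
      c-uncovered : ∀ {k} → k ∈ S → ¬ k ∋ c
      c-uncovered k∈ kc with meet-trans′ (∈′ k∈ (≢u kc (≢-sym a≢c) (≢-sym b≢c))) v∈′ (∈′ g∈ g≢u)
                                         (c , kc , vc) (a , va , ga)
      ... | r , kr , gr with ∋-either a≢t ga gt gr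
      ...   | inj₁ refl = ≢v k∈ (∋-unique a≢c kr kc va vc)
      ...   | inj₂ refl =
        ¬meet-apart a≢b (≢-sym t≢c) ua ub kc kr a≢c a≢t b≢c (≢-sym t≢b)
          (meet-trans u∈ g∈ k∈ (a , ua , ga) (t , gt , kr))

  spare-off-u : ¬ Shared u a → ∀ {x} → x ≢ a → x ≢ b → Spare x → ⊥
  spare-off-u a-leaf x≢a x≢b x-spare =
    let (d , d-spare , ud) = leaf-spare u∈ ua a-leaf in
    no-two-spares (λ d≡x → u∌ x≢a x≢b (subst (u ∋_) d≡x ud)) d-spare x-spare

  -- if a is a leaf of u, an edge {c, w} ∈ S with w ∉ {a, b} has w as a leaf, so it has a spare point besides u's
  leaf-pivot : ¬ Shared u a → HasEdge S b c
  leaf-pivot a-leaf with ∃∈? (_∋? c) S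
  ... | no c-free = ⊥-elim (spare-off-u a-leaf (≢-sym a≢c) (≢-sym b≢c) (uncovered-spare λ k∈ kc → c-free (_ , k∈ , kc)))
  ... | yes (k , k∈ , kc) with other k c ≟ b | other k c ≟ a
  ...   | yes w≡b | _       = k , k∈ , subst (k ∋_) w≡b (∋-other k c) , kc
  ...   | no _    | yes w≡a = ⊥-elim (≢v k∈ (∋-unique a≢c (subst (k ∋_) w≡a (∋-other k c)) kc va vc))
  ...   | no w≢b  | no w≢a  =
    let (d′ , d′-spare , kd′) = leaf-spare k∈ (∋-other k c) w-leaf in
    ⊥-elim (spare-off-u′ (∋-either (other-≢ kc) kc (∋-other k c) kd′) d′-spare)
    where
      w : Fin n
      w = other k c
      spare-off-u′ : ∀ {x} → x ≡ c ⊎ x ≡ w → Spare x → ⊥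
      spare-off-u′ (inj₁ refl) = spare-off-u a-leaf (≢-sym a≢c) (≢-sym b≢c)
      spare-off-u′ (inj₂ refl) = spare-off-u a-leaf w≢a w≢b
      w-leaf : ¬ Shared k w
      w-leaf (m , m∈ , m≢k , mw)
        with meet-trans′ v∈′ (∈′ k∈ (≢u kc (≢-sym a≢c) (≢-sym b≢c))) (∈′ m∈ (≢u mw w≢a w≢b))
                         (c , vc , kc) (w , ∋-other k c , mw)
      ... | r , vr , mr with ∋-either a≢c va vc vr
      ...   | inj₁ refl = a-leaf (m , m∈ , ≢u mw w≢a w≢b , mr)
      ...   | inj₂ refl = m≢k (∋-unique (other-≢ kc) mr mw kc (∋-other k c))

  pivot : HasEdge S b c
  pivot with shared? u a
  ... | yes a-shared = ⊥-elim (shared-pivot-impossible a-shared)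
  ... | no a-leaf    = leaf-pivot a-leaf

  h : Edge
  h = proj₁ pivot
  h∈ : h ∈ S
  h∈ = proj₁ (proj₂ pivot)
  hb : h ∋ b
  hb = proj₁ (proj₂ (proj₂ pivot))
  hc : h ∋ c
  hc = proj₂ (proj₂ (proj₂ pivot))
  u-meets-h : Meet u h
  u-meets-h = b , ub , hb
  covers : ∀ {x} → v ∋ x → u ∋ x ⊎ h ∋ x
  covers vx with ∋-either a≢c va vc vx
  ... | inj₁ refl = inj₁ ua
  ... | inj₂ refl = inj₂ hc
  meets-both : ∀ {f} → f ∈ S → Meet v f → Meet u f × Meet h f
  meets-both f∈ (r , vr , fr) with ∋-either a≢c va vc vr
  ... | inj₁ refl = (a , ua , fr) , meet-trans h∈ u∈ f∈ (meet-sym u-meets-h) (a , ua , fr)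
  ... | inj₂ refl = meet-trans u∈ h∈ f∈ u-meets-h (c , hc , fr) , (c , hc , fr)
  from-v : ∀ {p q f} → Separated S p q → v ∋ p → f ∈ S → f ∋ q → Meet v f → ⊥
  from-v separated vp f∈ fq vf with covers vp
  ... | inj₁ up = separated u∈ f∈ up fq (proj₁ (meets-both f∈ vf))
  ... | inj₂ hp = separated h∈ f∈ hp fq (proj₂ (meets-both f∈ vf))

  separated-preserved : ∀ {p q} → Separated S p q → Separated S′ p q
  separated-preserved {p} {q} separated e∈ f∈ ep fq ef
    with ∈-swap⁻ xs (proj₁ gp) e∈ | ∈-swap⁻ xs (proj₁ gp) f∈
  ... | inj₂ (e∈S , _) | inj₂ (f∈S , _) = separated e∈S f∈S ep fq ef
  ... | inj₁ refl      | inj₂ (f∈S , _) = from-v separated ep f∈S fq ef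
  ... | inj₂ (e∈S , _) | inj₁ refl      = from-v (separated-sym separated) fq e∈S ep (meet-sym ef)
  ... | inj₁ refl      | inj₁ refl      with covers ep | covers fq
  ...   | inj₁ up | inj₁ uq = separated u∈ u∈ up uq (meet-refl u)
  ...   | inj₁ up | inj₂ hq = separated u∈ h∈ up hq u-meets-h
  ...   | inj₂ hp | inj₁ uq = separated h∈ u∈ hp uq (meet-sym u-meets-h)
  ...   | inj₂ hp | inj₂ hq = separated h∈ h∈ hp hq (meet-refl h)

module UpperBound {n : ℕ} (3<n : 3 ℕ.< n) where
  open Edges {n}
  open LineGraph {n}
  open Swap {Edge}
  open Tours L

  SpanningStar : List Edge → Fin n → Set
  SpanningStar S y = (∀ {e} → e ∈ S → e ∋ y) × (∀ z → z ≢ y → HasEdge S y z)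

  spanning-star-frozen : ∀ {S S′ y} → SpanningStar S y → ¬ LegalMove L S S′
  spanning-star-frozen {y = y} (all∋y , full) (xs , ys , u , v , refl , refl , u-adj-v , v∉ , gp′)
    with v ∋? y
  ... | yes vy = v∉ (has⇒∈ (other-≢ vy) (full (other v y) (≢-sym (other-≢ vy))) vy (∋-other v y))
  ... | no v∌y with adj⇒meet u-adj-v
  ...   | a , ua , va with avoid-three 3<n y a (other v a)
  ...     | z , z≢y , z≢a , z≢c with full (other v a) (∋∌⇒≢ (∋-other v a) v∌y) | full z z≢y
  ...       | e , e∈ , ey , ec | f , f∈ , fy , fz =
    ¬meet-apart (other-≢ va) (≢-sym z≢y) va (∋-other v a) fy fz a≢y (≢-sym z≢a) c≢y (≢-sym z≢c)
      (gp⇒meet-trans gp′ (∈-insert xs) (∈-swap⁺ xs e∈ (≢u ec c≢y (≢-sym (other-≢ va))))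
                     (∈-swap⁺ xs f∈ (≢u fz z≢y z≢a)) (other v a , ∋-other v a , ec) (y , ey , fy))
    where
      a≢y : a ≢ y
      a≢y = ∋∌⇒≢ va v∌y
      c≢y : other v a ≢ y
      c≢y = ∋∌⇒≢ (∋-other v a) v∌y
      ≢u : ∀ {g x} → g ∋ x → x ≢ y → x ≢ a → g ≢ u
      ≢u gx x≢y x≢a refl = ∌-third (≢-sym a≢y) (all∋y (∈-insert xs)) ua x≢y x≢a gx

  nonempty : ∀ {S : List Edge} → n ≤ suc (length S) → ∃ (_∈ S)
  nonempty {[]}    n≤1 with ℕP.≤-trans 3<n n≤1
  ... | s≤s ()
  nonempty {e ∷ _} _   = e , here refl

  module _ {S : List Edge} (gp : IsGeneralPosition L S) where
    open PrivatePoints gp using (Shared; shared?; meet-trans)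

    Near : Edge → Set
    Near u = ∀ q → q ≢ lo u → q ≢ hi u → HasEdge S (lo u) q ⊎ HasEdge S (hi u) q

    Far : Edge → Fin n → Set
    Far u q = q ≢ lo u × q ≢ hi u × ¬ HasEdge S (lo u) q × ¬ HasEdge S (hi u) q

    far? : ∀ u q → Dec (Far u q)
    far? u q = ¬? (q ≟ lo u) ×-dec ¬? (q ≟ hi u) ×-dec ¬? (has? S (lo u) q) ×-dec ¬? (has? S (hi u) q)

    near-if-none-far : ∀ {u} → ¬ ∃ (Far u) → Near u
    near-if-none-far {u} none-far q q≢a q≢b with has? S (lo u) q | has? S (hi u) q
    ... | yes aq | _      = inj₁ aq
    ... | no _   | yes bq = inj₂ bq
    ... | no ¬aq | no ¬bq = ⊥-elim (none-far (q , q≢a , q≢b , ¬aq , ¬bq))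

    far-separated : ∀ {u q} → u ∈ S → Far u q → Separated S (lo u) q
    far-separated {u} u∈ (_ , _ , ¬aq , ¬bq) e∈ f∈ ea fq ef with meet-trans u∈ e∈ f∈ (lo u , ∋-lo u , ea) ef
    ... | r , ur , fr with ∋-either (lo≢hi u) (∋-lo u) (∋-hi u) ur
    ...   | inj₁ refl = ¬aq (_ , f∈ , fr , fq)
    ...   | inj₂ refl = ¬bq (_ , f∈ , fr , fq)

    spanning-star-at : ∀ {u x y} → u ∈ S → u ∋ x → u ∋ y → x ≢ y → ¬ Shared u x →
                       (∀ q → q ≢ x → q ≢ y → HasEdge S x q ⊎ HasEdge S y q) → SpanningStar S y
    spanning-star-at {u} {x} {y} u∈ ux uy x≢y x-leaf near = all∋y , full
      where
        full : ∀ z → z ≢ y → HasEdge S y z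
        full z z≢y with z ≟ x
        ... | yes refl = u , u∈ , uy , ux
        ... | no z≢x with near z z≢x z≢y
        ...   | inj₂ yz = yz
        ...   | inj₁ (e , e∈ , ex , ez) =
          ⊥-elim (x-leaf (e , e∈ , (λ { refl → ∌-third x≢y ux uy z≢x z≢y ez }) , ex))
        all∋y : ∀ {e} → e ∈ S → e ∋ y
        all∋y {e} e∈ with e ∋? y
        ... | yes ey = ey
        ... | no e∌y with avoid-three 3<n y (lo e) (hi e)
        ...   | z , z≢y , z≢lo , z≢hi with full (lo e) (∋∌⇒≢ (∋-lo e) e∌y) | full z z≢y
        ...     | e₁ , e₁∈ , e₁y , e₁lo | e₂ , e₂∈ , e₂y , e₂z =
          ⊥-elim (¬meet-apart (lo≢hi e) (≢-sym z≢y) (∋-lo e) (∋-hi e) e₂y e₂z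
                    (∋∌⇒≢ (∋-lo e) e∌y) (≢-sym z≢lo) (∋∌⇒≢ (∋-hi e) e∌y) (≢-sym z≢hi)
                    (meet-trans e∈ e₁∈ e₂∈ (lo e , ∋-lo e , e₁lo) (y , e₁y , e₂y)))

    -- a triangle on the endpoints of u leaves no room for the edges to a fourth point
    both-ends-shared-impossible : ∀ {u} → u ∈ S → Shared u (lo u) → Shared u (hi u) → Near u → ⊥
    both-ends-shared-impossible {u} u∈ (g , g∈ , g≢u , ga) (g′ , g′∈ , g′≢u , g′b) near =
      let (z , z≢a , z≢b , z≢t) = avoid-three 3<n a b t in
      fourth-point z≢a z≢b z≢t (near z z≢a z≢b)
      where
        a b t : Fin n
        a = lo u
        b = hi u
        t = other g a
        gt : g ∋ t
        gt = ∋-other g a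
        a≢t : a ≢ t
        a≢t = other-≢ ga
        t≢b : t ≢ b
        t≢b t≡b = g≢u (∋-unique (lo≢hi u) ga (subst (g ∋_) t≡b gt) (∋-lo u) (∋-hi u))
        g′t : g′ ∋ t
        g′t with meet-trans g∈ u∈ g′∈ (a , ga , ∋-lo u) (b , ∋-hi u , g′b)
        ... | r , gr , g′r with ∋-either a≢t ga gt gr
        ...   | inj₁ refl = ⊥-elim (g′≢u (∋-unique (lo≢hi u) g′r g′b (∋-lo u) (∋-hi u)))
        ...   | inj₂ refl = g′r
        fourth-point : ∀ {z} → z ≢ a → z ≢ b → z ≢ t → HasEdge S a z ⊎ HasEdge S b z → ⊥
        fourth-point z≢a z≢b z≢t (inj₁ (e , e∈ , ea , ez)) =
          ¬meet-apart (≢-sym z≢a) (≢-sym t≢b) ea ez g′b g′t (lo≢hi u) a≢t z≢b z≢t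
            (meet-trans e∈ g∈ g′∈ (a , ea , ga) (t , gt , g′t))
        fourth-point z≢a z≢b z≢t (inj₂ (e , e∈ , eb , ez)) =
          ¬meet-apart (≢-sym z≢b) a≢t eb ez ga gt (≢-sym (lo≢hi u)) (≢-sym t≢b) z≢a z≢t
            (meet-trans e∈ g′∈ g∈ (b , eb , g′b) (t , g′t , gt))

    separated-or-star : n ≤ suc (length S) → (∃₂ λ p q → p ≢ q × Separated S p q) ⊎ ∃ (SpanningStar S)
    separated-or-star large with nonempty large
    ... | u , u∈ with any? (far? u)
    ...   | yes (q , far) = inj₁ (lo u , q , ≢-sym (proj₁ far) , far-separated u∈ far)
    ...   | no none-far with shared? u (lo u) | shared? u (hi u)
    ...     | no lo-leaf | _          =
      inj₂ (hi u , spanning-star-at u∈ (∋-lo u) (∋-hi u) (lo≢hi u) lo-leaf (near-if-none-far {u} none-far))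
    ...     | yes _      | no hi-leaf =
      inj₂ (lo u , spanning-star-at u∈ (∋-hi u) (∋-lo u) (≢-sym (lo≢hi u)) hi-leaf
                     (λ q q≢b q≢a → Sum.swap (near-if-none-far {u} none-far q q≢a q≢b)))
    ...     | yes lo-sh  | yes hi-sh  = ⊥-elim (both-ends-shared-impossible u∈ lo-sh hi-sh (near-if-none-far {u} none-far))

  Invariant : Fin n → Fin n → List Edge → Set
  Invariant p q C = IsGeneralPosition L C × n ≤ suc (length C) × Separated C p q

  invariant-preserved : ∀ {p q C C′} → Invariant p q C → LegalMove L C C′ → Invariant p q C′
  invariant-preserved (gp , large , separated) (xs , ys , u , v , refl , refl , u-adj-v , v∉ , gp′) =
    gp′ , subst (λ l → n ≤ suc l) (length-swap xs) large ,
    AfterMove.separated-preserved gp large u-adj-v v∉ gp′ separated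

  mobile-small : ∀ {S} → IsMobileGP L S → ¬ n ≤ suc (length S)
  mobile-small {S} (gp , cs , run , visits) large with separated-or-star gp large
  ... | inj₁ (p , q , p≢q , separated) with visits (edge p q p≢q)
  ...   | C , C∈ , pq∈C =
    proj₂ (proj₂ (run-invariant (Invariant p q) invariant-preserved (gp , large , separated) run C∈))
      pq∈C pq∈C (edge-∋ˡ p≢q) (edge-∋ʳ p≢q) (meet-refl _)
  mobile-small {S} (gp , cs , run , visits) large | inj₂ (y , star@(all∋y , _))
    with avoid-three 3<n y y y
  ... | x₁ , x₁≢y , _ with avoid-three 3<n y x₁ x₁
  ...   | x₂ , x₂≢y , x₂≢x₁ , _ with visits (edge x₂ x₁ x₂≢x₁)
  ...     | C , C∈ , e∈C with run-invariant (_≡ S) (λ { refl move → ⊥-elim (spanning-star-frozen star move) }) refl run C∈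
  ...       | refl = ∌-third x₂≢x₁ (edge-∋ˡ x₂≢x₁) (edge-∋ʳ x₂≢x₁) (≢-sym x₂≢y) (≢-sym x₁≢y) (all∋y e∈C)

theorem3p2 : ∀ (n : ℕ) → 4 ≤ n → MobEq (LineK n) (n ∸ 2)
theorem3p2 .(suc (suc (suc (suc k)))) 4≤n@(s≤s (s≤s (s≤s (s≤s (z≤n {k}))))) =
  LowerBound.lower-bound k , λ S mobile → ℕP.≤-pred (ℕP.≤-pred (ℕP.≰⇒> (UpperBound.mobile-small 4≤n mobile)))
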